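{- For all positive integers $m$ and $n$, $$\sum_{T\in\mathcal{T}_{(n^m)}} t^{\operatorname{des}(T)}=\sum_{\mathtt{w}\in\mathcal{N}(n,m)} t^{\operatorname{asc}(\mathtt{w})}.$$
   Context: For positive integers $m,n$, a lattice word of weight $(m^n)$ is a word $\mathtt{w}=w_1w_2\cdots w_{nm}$ in the symbols $1,2,\ldots,m$ such that (a) each $i$ with $1\le i\le m$ occurs exactly $n$ times, and (b) for each $1\le r\le nm$ and each $1\le i\le m-1$, the number of $i$'s in $w_1\cdots w_r$ is at least the number of $(i+1)$'s in $w_1\cdots w_r$. Let $\mathcal{N}(n,m)$ be the set of such words. An ascent of a word $\mathtt{w}=w_1\cdots w_p$ is an index $i$ with $w_i<w_{i+1}$, and $\operatorname{asc}(\mathtt{w})$ is the number of ascents. $(n^m)$ denotes the partition with $m$ parts all equal to $n$ (rectangular diagram with $m$ rows of length $n$), and $\mathcal{T}_{(n^m)}$ is the set of standard Young tableaux of this shape. For a standard Young tableau $T$, $i$ is a descent of $T$ if $i+1$ appears in a strictly lower row of $T$ than $i$; $\operatorname{des}(T)$ is the number of descents of $T$. -}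

module Defs where

open import Data.Bool using (Bool; true; false; _∧_; _∨_; not)
open import Data.Nat using (ℕ; zero; suc; _+_; _*_; _^_; _≡ᵇ_; _<ᵇ_; _≤ᵇ_)
open import Data.Fin using (Fin; toℕ)
open import Data.List using (List; []; _∷_; map; concatMap; filterᵇ; sum; length; allFin; take; applyUpTo)
open import Data.Bool.ListAction using (and; or)
open import Data.Vec using (Vec; []; _∷_; lookup)
open import Data.Product using (_×_; _,_)

range : ℕ → ℕ → List ℕ
range a k = applyUpTo (a +_) k

allVecs : {A : Set} → List A → (k : ℕ) → List (Vec A k)
allVecs xs zero    = [] ∷ []
allVecs xs (suc k) = concatMap (λ x → map (x ∷_) (allVecs xs k)) xs

allLists : {A : Set} → List A → ℕ → List (List A)
allLists xs zero    = [] ∷ []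
allLists xs (suc k) = concatMap (λ x → map (x ∷_) (allLists xs k)) xs

countᵇ : {A : Set} → (A → Bool) → List A → ℕ
countᵇ p xs = length (filterᵇ p xs)

allᵇ : {A : Set} → (A → Bool) → List A → Bool
allᵇ p xs = and (map p xs)

anyᵇ : {A : Set} → (A → Bool) → List A → Bool
anyᵇ p xs = or (map p xs)

occ : ℕ → List ℕ → ℕ
occ i w = countᵇ (λ x → x ≡ᵇ i) w

-- condition (a): each i, 1 ≤ i ≤ m, occurs exactly n times
-- (together with the fact that candidate words only use symbols 1..m)
hasWeight : ℕ → ℕ → List ℕ → Bool
hasWeight n m w = allᵇ (λ i → occ i w ≡ᵇ n) (range 1 m)

isLatticeCond : ℕ → ℕ → List ℕ → Bool
isLatticeCond n m w =
  allᵇ (λ r → allᵇ (λ i → occ (suc i) (take r w) ≤ᵇ occ i (take r w))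
                   (range 1 (m Data.Nat.∸ 1)))
       (range 1 (n * m))

latticeWords : ℕ → ℕ → List (List ℕ)
latticeWords n m =
  filterᵇ (λ w → hasWeight n m w ∧ isLatticeCond n m w)
          (allLists (range 1 m) (n * m))

asc : List ℕ → ℕ
asc []           = 0
asc (x ∷ [])     = 0
asc (x ∷ y ∷ w)  = (if x <ᵇ y then 1 else 0) + asc (y ∷ w)
  where open import Data.Bool using (if_then_else_)

-- Standard Young tableaux of rectangular shape (n^m):
-- m rows (indexed by Fin m, row 0 on top) of length n (columns Fin n),
-- entries natural numbers.

Filling : ℕ → ℕ → Set
Filling n m = Vec (Vec ℕ n) m

entry : {n m : ℕ} → Filling n m → Fin m → Fin n → ℕ
entry T r c = lookup (lookup T r) c

cells : (n m : ℕ) → List (Fin m × Fin n)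
cells n m = concatMap (λ r → map (λ c → (r , c)) (allFin n)) (allFin m)

isBijective : {n m : ℕ} → Filling n m → Bool
isBijective {n} {m} T =
  allᵇ (λ v → countᵇ (λ { (r , c) → entry T r c ≡ᵇ v }) (cells n m) ≡ᵇ 1)
       (range 1 (n * m))

isIncreasing : {n m : ℕ} → Filling n m → Bool
isIncreasing {n} {m} T =
  allᵇ (λ { (r , c) → allᵇ (λ { (r' , c') →
      not ((r ≡ᵇF r') ∧ (toℕ c <ᵇ toℕ c')) ∨ (entry T r c <ᵇ entry T r' c') }) (cells n m) }) (cells n m)
  ∧
  allᵇ (λ { (r , c) → allᵇ (λ { (r' , c') →
      not ((c ≡ᵇF c') ∧ (toℕ r <ᵇ toℕ r')) ∨ (entry T r c <ᵇ entry T r' c') }) (cells n m) }) (cells n m)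
  where
  _≡ᵇF_ : {k : ℕ} → Fin k → Fin k → Bool
  a ≡ᵇF b = toℕ a ≡ᵇ toℕ b

syt : (n m : ℕ) → List (Filling n m)
syt n m =
  filterᵇ (λ T → isBijective T ∧ isIncreasing T)
          (allVecs (allVecs (range 1 (n * m)) n) m)

isDescent : {n m : ℕ} → Filling n m → ℕ → Bool
isDescent {n} {m} T i =
  anyᵇ (λ { (r , c) → anyᵇ (λ { (r' , c') →
      (entry T r c ≡ᵇ i) ∧ (entry T r' c' ≡ᵇ suc i) ∧ (toℕ r <ᵇ toℕ r') })
    (cells n m) }) (cells n m)

des : {n m : ℕ} → Filling n m → ℕ
des {n} {m} T = countᵇ (isDescent T) (range 1 (n * m Data.Nat.∸ 1))

module Submission where

-- The identity is proved bijectively, through the classical correspondence between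
-- standard Young tableaux of rectangular shape (n^m) and lattice (Yamanouchi) words of
-- weight (m^n).  The reading word of a tableau Y has, as its letter number k (k = 1 … nm),
-- one more than the index of the row of Y containing k.  Conversely the tableau of a word w
-- holds in cell (r, c) the position of the (c+1)-st occurrence of the letter r+1 in w.
-- Row strictness of Y says that the occurrences of each letter are read in order, column
-- strictness is exactly the lattice condition on prefixes, and a descent i of Y (i+1 in a
-- lower row than i) is exactly an ascent of the reading word at position i.  So reading is
-- a bijection from 𝒯_(n^m) onto 𝒩(n,m) that turns des into asc, and the two sums agree.

open import Defs
open import Data.Bool using (Bool; true; false; T; T?; not; _∧_; _∨_; if_then_else_)
open import Data.Bool.Properties using (T-∧; T-∨; T-≡; ⇔→≡)
open import Data.Empty using (⊥-elim)
open import Data.Fin using (Fin; toℕ; fromℕ<)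
import Data.Fin as Fin
import Data.Fin.Properties as Finₚ
open import Data.List using (List; []; _∷_; _++_; map; length; take; allFin; applyUpTo; concatMap; filterᵇ; findᵇ; upTo; cartesianProductWith; cartesianProduct)
import Data.List.Properties as Listₚ
open import Data.List.Membership.Propositional using (_∈_)
open import Data.List.Membership.Propositional.Properties
open import Data.List.Relation.Unary.Any using (here; there)
import Data.List.Relation.Unary.All as All
import Data.List.Relation.Unary.All.Properties as Allₚ
open import Data.List.Relation.Binary.BagAndSetEquality using (∼bag⇒↭)
open import Data.List.Relation.Binary.Permutation.Propositional using (_↭_)
import Data.List.Relation.Binary.Permutation.Propositional.Properties as Permutationₚ
open import Data.List.Membership.Propositional.Properties.WithK using (unique∧set⇒bag)
open import Data.Nat.ListAction.Properties using (sum-↭)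
open import Data.List.Relation.Unary.Unique.Propositional using (Unique; []; _∷_)
import Data.List.Relation.Unary.Unique.Propositional.Properties as Uniqueₚ
open import Data.Vec using (Vec; []; _∷_; lookup; tabulate)
import Data.Vec.Properties as Vecₚ
open import Data.Maybe using (just; maybe′)
open import Data.Nat using (ℕ; zero; suc; _+_; _*_; _∸_; _^_; _≤_; _<_; _<?_; z≤n; s≤s; _≡ᵇ_; _<ᵇ_; _≤ᵇ_)
open import Data.Nat.Properties
open import Data.Nat.ListAction using (sum)
open import Data.Product using (_×_; _,_; proj₁; proj₂; map₂; ∃-syntax)
open import Data.Sum using (inj₁; inj₂)
open import Data.Unit using (tt)
open import Function using (_∘_; _|>_; _⇔_; mk⇔; Equivalence)
open import Relation.Nullary using (¬_; yes; no)
open import Relation.Binary.PropositionalEquality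

open import Algebra.Properties.CommutativeSemigroup +-commutativeSemigroup
  using () renaming (interchange to +-interchange)

open Equivalence using (to; from)

private
  variable
    A B : Set

ι : Bool → ℕ
ι b = if b then 1 else 0

allᵇ⁺ : {p : A → Bool} (xs : List A) → (∀ {x} → x ∈ xs → T (p x)) → T (allᵇ p xs)
allᵇ⁺ []       h = tt
allᵇ⁺ (x ∷ xs) h = from T-∧ (h (here refl) , allᵇ⁺ xs (h ∘ there))

allᵇ⁻ : {p : A → Bool} {xs : List A} → T (allᵇ p xs) → ∀ {x} → x ∈ xs → T (p x)
allᵇ⁻ {xs = y ∷ ys} h (here refl) = proj₁ (to T-∧ h)
allᵇ⁻ {xs = y ∷ ys} h (there x∈)  = allᵇ⁻ (proj₂ (to T-∧ h)) x∈

anyᵇ⁺ : {p : A → Bool} {xs : List A} {x : A} → x ∈ xs → T (p x) → T (anyᵇ p xs)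
anyᵇ⁺ (here refl) px = from T-∨ (inj₁ px)
anyᵇ⁺ (there x∈)  px = from T-∨ (inj₂ (anyᵇ⁺ x∈ px))

anyᵇ⁻ : {p : A → Bool} (xs : List A) → T (anyᵇ p xs) → ∃[ x ] (x ∈ xs × T (p x))
anyᵇ⁻ (x ∷ xs) h with to T-∨ h
... | inj₁ px = x , here refl , px
... | inj₂ h′ with anyᵇ⁻ xs h′
...   | y , y∈ , py = y , there y∈ , py

implicationᵇ⁺ : ∀ {a b d} → (T a → T b → T d) → T (not (a ∧ b) ∨ d)
implicationᵇ⁺ {true}  {true}  h = h tt tt
implicationᵇ⁺ {true}  {false} h = tt
implicationᵇ⁺ {false}         h = tt

implicationᵇ⁻ : ∀ {a b d} → T (not (a ∧ b) ∨ d) → T a → T b → T d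
implicationᵇ⁻ {true} {true} h _ _ = h

T-ext : ∀ {a b} → (T a → T b) → (T b → T a) → a ≡ b
T-ext a⇒b b⇒a = ⇔→≡ {z = true} (mk⇔ (to T-≡ ∘ a⇒b ∘ from T-≡) (to T-≡ ∘ b⇒a ∘ from T-≡))

≡ᵇ-refl : ∀ a → (a ≡ᵇ a) ≡ true
≡ᵇ-refl a = to T-≡ (≡⇒≡ᵇ a a refl)

≢⇒≡ᵇ-false : ∀ {a b} → a ≢ b → (a ≡ᵇ b) ≡ false
≢⇒≡ᵇ-false {a} {b} a≢b with a ≡ᵇ b in eq
... | true  = ⊥-elim (a≢b (≡ᵇ⇒≡ a b (from T-≡ eq)))
... | false = refl

ι-≤ᵇ-suc : ∀ e p → ι (e ≤ᵇ suc p) ≡ ι (e ≤ᵇ p) + ι (e ≡ᵇ suc p)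
ι-≤ᵇ-suc zero    p = refl
ι-≤ᵇ-suc (suc a) p = ι-<ᵇ-suc a p
  where
  ι-<ᵇ-suc : ∀ a p → ι (a <ᵇ suc p) ≡ ι (a <ᵇ p) + ι (a ≡ᵇ p)
  ι-<ᵇ-suc zero    zero    = refl
  ι-<ᵇ-suc zero    (suc p) = refl
  ι-<ᵇ-suc (suc a) zero    = refl
  ι-<ᵇ-suc (suc a) (suc p) = ι-<ᵇ-suc a p

∈-filterᵇ⁺ : {p : A → Bool} {xs : List A} {x : A} → x ∈ xs → T (p x) → x ∈ filterᵇ p xs
∈-filterᵇ⁺ {p = p} = ∈-filter⁺ (T? ∘ p)

∈-filterᵇ⁻ : {p : A → Bool} {xs : List A} {x : A} → x ∈ filterᵇ p xs → x ∈ xs × T (p x)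
∈-filterᵇ⁻ {p = p} = ∈-filter⁻ (T? ∘ p)

countᵇ-∷ : (p : A → Bool) (x : A) (xs : List A) → countᵇ p (x ∷ xs) ≡ ι (p x) + countᵇ p xs
countᵇ-∷ p x xs with p x
... | true  = refl
... | false = refl

countᵇ-none : {p : A → Bool} (xs : List A) → (∀ {x} → x ∈ xs → ¬ T (p x)) → countᵇ p xs ≡ 0
countᵇ-none []             h = refl
countᵇ-none {p = p} (x ∷ xs) h with p x in px
... | true  = ⊥-elim (h (here refl) (from T-≡ px))
... | false = countᵇ-none xs (h ∘ there)

countᵇ-none⁻ : {p : A → Bool} (xs : List A) → countᵇ p xs ≡ 0 → ∀ {x} → x ∈ xs → ¬ T (p x)
countᵇ-none⁻ {p = p} (y ∷ xs) none x∈ px with p y in py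
countᵇ-none⁻ (y ∷ xs) none (here refl) px | false = subst T py px
countᵇ-none⁻ (y ∷ xs) none (there x∈)  px | false = countᵇ-none⁻ xs none x∈ px

countᵇ-every : {p : A → Bool} (xs : List A) → (∀ {x} → x ∈ xs → T (p x)) → countᵇ p xs ≡ length xs
countᵇ-every []             h = refl
countᵇ-every {p = p} (x ∷ xs) h with p x | h (here refl)
... | true | _ = cong suc (countᵇ-every xs (h ∘ there))

countᵇ-mono : {p q : A → Bool} (xs : List A) → (∀ {x} → x ∈ xs → T (p x) → T (q x)) →
              countᵇ p xs ≤ countᵇ q xs
countᵇ-mono [] h = z≤n
countᵇ-mono {p = p} {q} (x ∷ xs) h with p x | q x | h (here refl)
... | true  | true  | _  = s≤s (countᵇ-mono xs (h ∘ there))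
... | true  | false | pq = ⊥-elim (pq tt)
... | false | true  | _  = m≤n⇒m≤1+n (countᵇ-mono xs (h ∘ there))
... | false | false | _  = countᵇ-mono xs (h ∘ there)

countᵇ-split : {p q r : A → Bool} (xs : List A) →
               (∀ {x} → x ∈ xs → ι (r x) ≡ ι (p x) + ι (q x)) →
               countᵇ r xs ≡ countᵇ p xs + countᵇ q xs
countᵇ-split [] h = refl
countᵇ-split {p = p} {q} {r} (x ∷ xs) h = begin
  countᵇ r (x ∷ xs)                                  ≡⟨ countᵇ-∷ r x xs ⟩
  ι (r x) + countᵇ r xs                              ≡⟨ cong₂ _+_ (h (here refl)) (countᵇ-split xs (h ∘ there)) ⟩
  (ι (p x) + ι (q x)) + (countᵇ p xs + countᵇ q xs)  ≡⟨ +-interchange (ι (p x)) (ι (q x)) _ _ ⟩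
  (ι (p x) + countᵇ p xs) + (ι (q x) + countᵇ q xs)  ≡⟨ sym (cong₂ _+_ (countᵇ-∷ p x xs) (countᵇ-∷ q x xs)) ⟩
  countᵇ p (x ∷ xs) + countᵇ q (x ∷ xs)              ∎
  where open ≡-Reasoning

countᵇ-cong : {p q : A → Bool} (xs : List A) → (∀ {x} → x ∈ xs → p x ≡ q x) → countᵇ p xs ≡ countᵇ q xs
countᵇ-cong []       h = refl
countᵇ-cong {p = p} {q} (x ∷ xs) h = begin
  countᵇ p (x ∷ xs)       ≡⟨ countᵇ-∷ p x xs ⟩
  ι (p x) + countᵇ p xs   ≡⟨ cong₂ _+_ (cong ι (h (here refl))) (countᵇ-cong xs (h ∘ there)) ⟩
  ι (q x) + countᵇ q xs   ≡⟨ sym (countᵇ-∷ q x xs) ⟩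
  countᵇ q (x ∷ xs)       ∎
  where open ≡-Reasoning

countᵇ-map : (p : B → Bool) (f : A → B) (xs : List A) → countᵇ p (map f xs) ≡ countᵇ (p ∘ f) xs
countᵇ-map p f []       = refl
countᵇ-map p f (x ∷ xs) with p (f x)
... | true  = cong suc (countᵇ-map p f xs)
... | false = countᵇ-map p f xs

countᵇ≡1⁺ : {q : A → Bool} (xs : List A) → Unique xs → ∀ {z} → z ∈ xs → T (q z) →
            (∀ {x} → x ∈ xs → T (q x) → x ≡ z) → countᵇ q xs ≡ 1
countᵇ≡1⁺ {q = q} (x ∷ xs) (x∉ ∷ u) (here refl) qz only =
  trans (countᵇ-∷ q x xs) (trans (cong (_+ countᵇ q xs) (cong ι (to T-≡ qz)))
    (cong suc (countᵇ-none xs (λ y∈ qy → All.lookup x∉ y∈ (sym (only (there y∈) qy))))))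
countᵇ≡1⁺ {q = q} (x ∷ xs) (x∉ ∷ u) (there z∈) qz only with q x in qx
... | true  = ⊥-elim (All.lookup x∉ z∈ (only (here refl) (from T-≡ qx)))
... | false = countᵇ≡1⁺ xs u z∈ qz (only ∘ there)

countᵇ≡1⇒∃ : {q : A → Bool} (xs : List A) → countᵇ q xs ≡ 1 → ∃[ z ] (z ∈ xs × T (q z))
countᵇ≡1⇒∃ {q = q} (x ∷ xs) one with q x in qx
... | true  = x , here refl , from T-≡ qx
... | false with countᵇ≡1⇒∃ xs one
...   | z , z∈ , qz = z , there z∈ , qz

countᵇ≡1⇒unique : {q : A → Bool} (xs : List A) → countᵇ q xs ≡ 1 →
                  ∀ {x z} → x ∈ xs → z ∈ xs → T (q x) → T (q z) → x ≡ z
countᵇ≡1⇒unique {q = q} (y ∷ xs) one x∈ z∈ qx qz with q y in qy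
countᵇ≡1⇒unique (y ∷ xs) one (here refl) (here refl) qx qz | true = refl
countᵇ≡1⇒unique (y ∷ xs) one (here refl) (there z∈) qx qz | true =
  ⊥-elim (countᵇ-none⁻ xs (suc-injective one) z∈ qz)
countᵇ≡1⇒unique (y ∷ xs) one (there x∈) z∈ qx qz | true =
  ⊥-elim (countᵇ-none⁻ xs (suc-injective one) x∈ qx)
countᵇ≡1⇒unique (y ∷ xs) one (here refl) z∈ qx qz | false = ⊥-elim (subst T qy qx)
countᵇ≡1⇒unique (y ∷ xs) one (there x∈) (here refl) qx qz | false = ⊥-elim (subst T qy qz)
countᵇ≡1⇒unique (y ∷ xs) one (there x∈) (there z∈) qx qz | false = countᵇ≡1⇒unique xs one x∈ z∈ qx qz

findᵇ-only : {q : A → Bool} (xs : List A) → ∀ {z} → z ∈ xs → T (q z) →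
             (∀ {x} → x ∈ xs → T (q x) → x ≡ z) → findᵇ q xs ≡ just z
findᵇ-only {q = q} (y ∷ xs) z∈ qz only with q y in qy
... | true = cong just (only (here refl) (from T-≡ qy))
... | false with z∈
...   | here refl = ⊥-elim (subst T qy qz)
...   | there z∈′ = findᵇ-only xs z∈′ qz (only ∘ there)

countᵇ-below : ∀ k a → a ≤ k → countᵇ (λ (c : Fin k) → toℕ c <ᵇ a) (allFin k) ≡ a
countᵇ-below k       zero    _         = countᵇ-none (allFin k) (λ _ ())
countᵇ-below (suc k) (suc a) (s≤s a≤k) = cong suc (begin
  countᵇ (λ c → toℕ c <ᵇ suc a) (Data.List.tabulate {n = k} Fin.suc)
    ≡⟨ cong (countᵇ _) (sym (Listₚ.map-tabulate {n = k} (λ c → c) Fin.suc)) ⟩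
  countᵇ (λ c → toℕ c <ᵇ suc a) (map Fin.suc (allFin k))
    ≡⟨ countᵇ-map _ Fin.suc (allFin k) ⟩
  countᵇ (λ c → toℕ c <ᵇ a) (allFin k)
    ≡⟨ countᵇ-below k a a≤k ⟩
  a ∎)
  where open ≡-Reasoning

map-injectiveOn⁺ : (f : A → B) (xs : List A) → Unique xs →
                   (∀ {x y} → x ∈ xs → y ∈ xs → f x ≡ f y → x ≡ y) → Unique (map f xs)
map-injectiveOn⁺ f []       []         inj = []
map-injectiveOn⁺ f (x ∷ xs) (x∉ ∷ u) inj =
  Allₚ.map⁺ (All.tabulate (λ y∈ fx≡fy → All.lookup x∉ y∈ (inj (here refl) (there y∈) fx≡fy)))
  ∷ map-injectiveOn⁺ f xs u (λ x∈ y∈ → inj (there x∈) (there y∈))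

sum-bijection : {xs : List A} {ys : List B} (f : A → B) (g : B → A) (hᴬ : A → ℕ) (hᴮ : B → ℕ) →
                Unique xs → Unique ys →
                (∀ {x} → x ∈ xs → f x ∈ ys) → (∀ {y} → y ∈ ys → g y ∈ xs) →
                (∀ {x} → x ∈ xs → g (f x) ≡ x) → (∀ {y} → y ∈ ys → f (g y) ≡ y) →
                (∀ {x} → x ∈ xs → hᴬ x ≡ hᴮ (f x)) →
                sum (map hᴬ xs) ≡ sum (map hᴮ ys)
sum-bijection {xs = xs} {ys} f g hᴬ hᴮ uxs uys f∈ g∈ gf fg h≡ = begin
  sum (map hᴬ xs)         ≡⟨ cong sum (Listₚ.map-cong-local (All.tabulate h≡)) ⟩
  sum (map (hᴮ ∘ f) xs)   ≡⟨ cong sum (Listₚ.map-∘ xs) ⟩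
  sum (map hᴮ (map f xs)) ≡⟨ sum-↭ (Permutationₚ.map⁺ hᴮ image↭ys) ⟩
  sum (map hᴮ ys)         ∎
  where
  open ≡-Reasoning
  image↭ys : map f xs ↭ ys
  image↭ys = ∼bag⇒↭ (unique∧set⇒bag
    (map-injectiveOn⁺ f xs uxs (λ x∈ y∈ fx≡fy → trans (sym (gf x∈)) (trans (cong g fx≡fy) (gf y∈))))
    uys
    (mk⇔ (λ y∈ → ∈-map⁻ f y∈ |> λ { (x , x∈ , refl) → f∈ x∈ })
         (λ y∈ → subst (_∈ map f xs) (fg y∈) (∈-map⁺ f (g∈ y∈)))))

concatMap-map≡cartesianProductWith : {C : Set} (f : A → B → C) (xs : List A) (ys : List B) →
  concatMap (λ x → map (f x) ys) xs ≡ cartesianProductWith f xs ys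
concatMap-map≡cartesianProductWith f []       ys = refl
concatMap-map≡cartesianProductWith f (x ∷ xs) ys =
  cong (map (f x) ys ++_) (concatMap-map≡cartesianProductWith f xs ys)

allLists-unique : (xs : List A) → Unique xs → ∀ k → Unique (allLists xs k)
allLists-unique xs u zero    = All.[] ∷ []
allLists-unique xs u (suc k) =
  subst Unique (sym (concatMap-map≡cartesianProductWith _∷_ xs (allLists xs k)))
    (Uniqueₚ.cartesianProductWith⁺ _∷_ Listₚ.∷-injective u (allLists-unique xs u k))

∈-allLists⁺ : (xs : List A) (ys : List A) → (∀ {y} → y ∈ ys → y ∈ xs) → ys ∈ allLists xs (length ys)
∈-allLists⁺ xs []       h = here refl
∈-allLists⁺ xs (y ∷ ys) h =
  subst (y ∷ ys ∈_) (sym (concatMap-map≡cartesianProductWith _∷_ xs (allLists xs (length ys))))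
    (∈-cartesianProductWith⁺ _∷_ (h (here refl)) (∈-allLists⁺ xs ys (h ∘ there)))

∈-allLists⁻ : (xs : List A) (k : ℕ) {ys : List A} → ys ∈ allLists xs k →
              length ys ≡ k × (∀ {y} → y ∈ ys → y ∈ xs)
∈-allLists⁻ xs zero    (here refl) = refl , λ ()
∈-allLists⁻ xs (suc k) ys∈
  with ∈-cartesianProductWith⁻ _∷_ xs (allLists xs k)
         (subst (_ ∈_) (concatMap-map≡cartesianProductWith _∷_ xs (allLists xs k)) ys∈)
... | y , ys , y∈ , ys∈′ , refl with ∈-allLists⁻ xs k ys∈′
...   | len , h = cong suc len , λ { (here refl) → y∈ ; (there z∈) → h z∈ }

allVecs-unique : (xs : List A) → Unique xs → ∀ k → Unique (allVecs xs k)
allVecs-unique xs u zero    = All.[] ∷ []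
allVecs-unique xs u (suc k) =
  subst Unique (sym (concatMap-map≡cartesianProductWith _∷_ xs (allVecs xs k)))
    (Uniqueₚ.cartesianProductWith⁺ _∷_ Vecₚ.∷-injective u (allVecs-unique xs u k))

∈-allVecs⁺ : (xs : List A) {k : ℕ} (v : Vec A k) → (∀ i → lookup v i ∈ xs) → v ∈ allVecs xs k
∈-allVecs⁺ xs []       h = here refl
∈-allVecs⁺ xs {suc k} (y ∷ v) h =
  subst (y ∷ v ∈_) (sym (concatMap-map≡cartesianProductWith _∷_ xs (allVecs xs k)))
    (∈-cartesianProductWith⁺ _∷_ (h Fin.zero) (∈-allVecs⁺ xs v (h ∘ Fin.suc)))

∈-allVecs⁻ : (xs : List A) (k : ℕ) {v : Vec A k} → v ∈ allVecs xs k → ∀ i → lookup v i ∈ xs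
∈-allVecs⁻ xs (suc k) v∈
  with ∈-cartesianProductWith⁻ _∷_ xs (allVecs xs k)
         (subst (_ ∈_) (concatMap-map≡cartesianProductWith _∷_ xs (allVecs xs k)) v∈)
... | y , v , y∈ , v∈′ , refl = λ { Fin.zero → y∈ ; (Fin.suc i) → ∈-allVecs⁻ xs k v∈′ i }

cells≡cartesianProduct : ∀ n m → cells n m ≡ cartesianProduct (allFin m) (allFin n)
cells≡cartesianProduct n m = concatMap-map≡cartesianProductWith _,_ (allFin m) (allFin n)

cells-unique : ∀ n m → Unique (cells n m)
cells-unique n m = subst Unique (sym (cells≡cartesianProduct n m))
  (Uniqueₚ.cartesianProduct⁺ (Uniqueₚ.allFin⁺ m) (Uniqueₚ.allFin⁺ n))

∈-cells : ∀ {n m} (r : Fin m) (c : Fin n) → (r , c) ∈ cells n m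
∈-cells {n} {m} r c = subst ((r , c) ∈_) (sym (cells≡cartesianProduct n m))
  (∈-cartesianProduct⁺ (∈-allFin r) (∈-allFin c))

∈-range⁻ : ∀ {a k v} → v ∈ range a k → a ≤ v × v < a + k
∈-range⁻ {a} v∈ with ∈-applyUpTo⁻ (a +_) v∈
... | i , i<k , refl = m≤m+n a i , +-monoʳ-< a i<k

∈-range⁺ : ∀ {a k v} → a ≤ v → v < a + k → v ∈ range a k
∈-range⁺ {a} {k} a≤v v<a+k with m≤n⇒∃[o]m+o≡n a≤v
... | i , refl = ∈-applyUpTo⁺ (a +_) (+-cancelˡ-< a _ _ v<a+k)

range-unique : ∀ a k → Unique (range a k)
range-unique a k = Uniqueₚ.applyUpTo⁺₁ (a +_) k (λ i<j _ → <⇒≢ i<j ∘ +-cancelˡ-≡ a _ _)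

-- The letter in position j (counted from 0) of a word; 0 beyond its end.
letterAt : List ℕ → ℕ → ℕ
letterAt []      j       = 0
letterAt (x ∷ w) zero    = x
letterAt (x ∷ w) (suc j) = letterAt w j

letterAt-∈ : ∀ w j → j < length w → letterAt w j ∈ w
letterAt-∈ (x ∷ w) zero    _   = here refl
letterAt-∈ (x ∷ w) (suc j) j<∣w∣ = there (letterAt-∈ w j (≤-pred j<∣w∣))

occ-∷ : ∀ s x w → occ s (x ∷ w) ≡ ι (x ≡ᵇ s) + occ s w
occ-∷ s = countᵇ-∷ (_≡ᵇ s)

occ-take-suc : ∀ s j w → j < length w →
               occ s (take (suc j) w) ≡ occ s (take j w) + ι (letterAt w j ≡ᵇ s)
occ-take-suc s zero    (x ∷ w) _ with x ≡ᵇ s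
... | true  = refl
... | false = refl
occ-take-suc s (suc j) (x ∷ w) j<∣w∣ with x ≡ᵇ s
... | true  = cong suc (occ-take-suc s j w (≤-pred j<∣w∣))
... | false = occ-take-suc s j w (≤-pred j<∣w∣)

occ-take-≤ : ∀ s p w → occ s (take p w) ≤ occ s w
occ-take-≤ s zero    w       = z≤n
occ-take-≤ s (suc p) []      = z≤n
occ-take-≤ s (suc p) (x ∷ w) with x ≡ᵇ s
... | true  = s≤s (occ-take-≤ s p w)
... | false = occ-take-≤ s p w

occ-take-< : ∀ s j w → j < length w → letterAt w j ≡ s → occ s (take j w) < occ s w
occ-take-< s j w j<∣w∣ refl = begin-strict
  occ s (take j w)                     <⟨ n<1+n _ ⟩
  suc (occ s (take j w))               ≡⟨ +-comm 1 _ ⟩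
  occ s (take j w) + 1                 ≡⟨ cong (λ b → occ s (take j w) + ι b) (sym (≡ᵇ-refl s)) ⟩
  occ s (take j w) + ι (s ≡ᵇ s)        ≡⟨ sym (occ-take-suc s j w j<∣w∣) ⟩
  occ s (take (suc j) w)               ≤⟨ occ-take-≤ s (suc j) w ⟩
  occ s w                              ∎
  where open ≤-Reasoning

occ-take-length : ∀ s w → occ s (take (length w) w) ≡ occ s w
occ-take-length s w = cong (occ s) (Listₚ.take-all (length w) w ≤-refl)

mutual
  -- pos s c w: the position (from 0) of the occurrence number c (from 0) of s in w.
  pos : ℕ → ℕ → List ℕ → ℕ
  pos s c []      = 0
  pos s c (x ∷ w) = pos-after (x ≡ᵇ s) s c w

  pos-after : Bool → ℕ → ℕ → List ℕ → ℕ
  pos-after true  s zero    w = 0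
  pos-after true  s (suc c) w = suc (pos s c w)
  pos-after false s c       w = suc (pos s c w)

pos-spec : ∀ s c w → c < occ s w →
           pos s c w < length w × letterAt w (pos s c w) ≡ s × occ s (take (pos s c w) w) ≡ c
pos-spec s zero    (x ∷ w) c<occ with x ≡ᵇ s in x≡ᵇs
... | true  = s≤s z≤n , ≡ᵇ⇒≡ x s (from T-≡ x≡ᵇs) , refl
... | false with pos-spec s zero w c<occ
...   | p<∣w∣ , at≡s , occ≡c =
  s≤s p<∣w∣ , at≡s , trans (occ-∷ s x _) (cong₂ (λ b o → ι b + o) x≡ᵇs occ≡c)
pos-spec s (suc c) (x ∷ w) c<occ with x ≡ᵇ s in x≡ᵇs
... | true  with pos-spec s c w (≤-pred c<occ)
...   | p<∣w∣ , at≡s , occ≡c =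
  s≤s p<∣w∣ , at≡s , trans (occ-∷ s x _) (cong₂ (λ b o → ι b + o) x≡ᵇs occ≡c)
pos-spec s (suc c) (x ∷ w) c<occ | false with pos-spec s (suc c) w c<occ
...   | p<∣w∣ , at≡s , occ≡c =
  s≤s p<∣w∣ , at≡s , trans (occ-∷ s x _) (cong₂ (λ b o → ι b + o) x≡ᵇs occ≡c)

pos-occ : ∀ s j w → j < length w → letterAt w j ≡ s → pos s (occ s (take j w)) w ≡ j
pos-occ s zero    (x ∷ w) _     refl rewrite ≡ᵇ-refl x = refl
pos-occ s (suc j) (x ∷ w) j<∣w∣ at≡s with x ≡ᵇ s
... | true  = cong suc (pos-occ s j w (≤-pred j<∣w∣) at≡s)
... | false = cong suc (pos-occ s j w (≤-pred j<∣w∣) at≡s)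

pos-mono : ∀ s c c′ w → c < c′ → c′ < occ s w → pos s c w < pos s c′ w
pos-mono s zero    (suc c′) (x ∷ w) c<c′ c′<occ with x ≡ᵇ s
... | true  = s≤s z≤n
... | false = s≤s (pos-mono s zero (suc c′) w c<c′ c′<occ)
pos-mono s (suc c) (suc c′) (x ∷ w) c<c′ c′<occ with x ≡ᵇ s
... | true  = s≤s (pos-mono s c c′ w (≤-pred c<c′) (≤-pred c′<occ))
... | false = s≤s (pos-mono s (suc c) (suc c′) w c<c′ c′<occ)

pos-<-prefix : ∀ s c p w → c < occ s (take p w) → pos s c w < p
pos-<-prefix s zero    (suc p) (x ∷ w) c<occ with x ≡ᵇ s
... | true  = s≤s z≤n
... | false = s≤s (pos-<-prefix s zero p w c<occ)
pos-<-prefix s (suc c) (suc p) (x ∷ w) c<occ with x ≡ᵇ s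
... | true  = s≤s (pos-<-prefix s c p w (≤-pred c<occ))
... | false = s≤s (pos-<-prefix s (suc c) p w c<occ)

applyUpTo-cong-< : ∀ {f g : ℕ → A} k → (∀ {j} → j < k → f j ≡ g j) → applyUpTo f k ≡ applyUpTo g k
applyUpTo-cong-< zero    h = refl
applyUpTo-cong-< (suc k) h = cong₂ _∷_ (h (s≤s z≤n)) (applyUpTo-cong-< k (h ∘ s≤s))

letterAt-applyUpTo : ∀ (g : ℕ → ℕ) {k j} → j < k → letterAt (applyUpTo g k) j ≡ g j
letterAt-applyUpTo g {suc k} {zero}  _   = refl
letterAt-applyUpTo g {suc k} {suc j} j<k = letterAt-applyUpTo (g ∘ suc) (≤-pred j<k)

applyUpTo-letterAt : ∀ w → applyUpTo (letterAt w) (length w) ≡ w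
applyUpTo-letterAt []      = refl
applyUpTo-letterAt (x ∷ w) = cong (x ∷_) (applyUpTo-letterAt w)

asc-applyUpTo : ∀ (g : ℕ → ℕ) k →
                asc (applyUpTo g k) ≡ countᵇ (λ j → g j <ᵇ g (suc j)) (upTo (k ∸ 1))
asc-applyUpTo g zero          = refl
asc-applyUpTo g (suc zero)    = refl
asc-applyUpTo g (suc (suc k)) = begin
  asc (applyUpTo g (suc (suc k)))
    ≡⟨ cong (ι (g 0 <ᵇ g 1) +_) (asc-applyUpTo (g ∘ suc) (suc k)) ⟩
  ι (g 0 <ᵇ g 1) + countᵇ (λ j → g (suc j) <ᵇ g (suc (suc j))) (upTo k)
    ≡⟨ cong (ι (g 0 <ᵇ g 1) +_) (sym (countᵇ-map _ suc (upTo k))) ⟩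
  ι (g 0 <ᵇ g 1) + countᵇ ascentAt (map suc (upTo k))
    ≡⟨ cong (λ js → ι (g 0 <ᵇ g 1) + countᵇ ascentAt js) (Listₚ.map-upTo suc k) ⟩
  ι (ascentAt 0) + countᵇ ascentAt (applyUpTo suc k)
    ≡⟨ sym (countᵇ-∷ ascentAt 0 (applyUpTo suc k)) ⟩
  countᵇ ascentAt (upTo (suc k)) ∎
  where
  open ≡-Reasoning
  ascentAt : ℕ → Bool
  ascentAt j = g j <ᵇ g (suc j)

<1+pred⇒< : ∀ {i k} → 1 ≤ i → i < 1 + (k ∸ 1) → i < k
<1+pred⇒< {k = zero}  (s≤s z≤n) (s≤s ())
<1+pred⇒< {k = suc k} _         i<k = i<k

<⇒<1+pred : ∀ {i k} → i < k → i < 1 + (k ∸ 1)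
<⇒<1+pred {k = suc k} i<k = i<k

module RectangularShape (n m : ℕ) where

  N : ℕ
  N = n * m

  Cell : Set
  Cell = Fin m × Fin n

  valueAt : Filling n m → Cell → ℕ
  valueAt Y (r , c) = entry Y r c

  rowTest colTest : Filling n m → Cell → Cell → Bool
  rowTest Y (r , c) (r′ , c′) = not ((toℕ r ≡ᵇ toℕ r′) ∧ (toℕ c <ᵇ toℕ c′)) ∨ (entry Y r c <ᵇ entry Y r′ c′)
  colTest Y (r , c) (r′ , c′) = not ((toℕ c ≡ᵇ toℕ c′) ∧ (toℕ r <ᵇ toℕ r′)) ∨ (entry Y r c <ᵇ entry Y r′ c′)

  everyPair : (Cell → Cell → Bool) → Bool
  everyPair test = allᵇ (λ x → allᵇ (test x) (cells n m)) (cells n m)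

  increasing⇔ : ∀ Y → T (isIncreasing Y) ⇔ (T (everyPair (rowTest Y)) × T (everyPair (colTest Y)))
  increasing⇔ Y = T-∧

  record IsSYT (Y : Filling n m) : Set where
    field
      inRange    : ∀ r c → 1 ≤ entry Y r c × entry Y r c ≤ N
      occursOnce : ∀ {v} → 1 ≤ v → v ≤ N → countᵇ (λ x → valueAt Y x ≡ᵇ v) (cells n m) ≡ 1
      rowsIncr   : ∀ {r c c′} → toℕ c < toℕ c′ → entry Y r c < entry Y r c′
      colsIncr   : ∀ {r r′ c} → toℕ r < toℕ r′ → entry Y r c < entry Y r′ c

  syt⇒IsSYT : ∀ {Y} → Y ∈ syt n m → IsSYT Y
  syt⇒IsSYT {Y} Y∈ = record
    { inRange    = λ r c → map₂ ≤-pred (∈-range⁻ (∈-allVecs⁻ _ n (∈-allVecs⁻ _ m Y∈fillings r) c))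
    ; occursOnce = λ 1≤v v≤N → ≡ᵇ⇒≡ _ _ (allᵇ⁻ {xs = range 1 N} bijective (∈-range⁺ 1≤v (s≤s v≤N)))
    ; rowsIncr   = λ {r} {c} {c′} c<c′ → <ᵇ⇒< _ _ (implicationᵇ⁻
        (allᵇ⁻ (allᵇ⁻ rowsOK (∈-cells r c)) (∈-cells r c′)) (≡⇒≡ᵇ (toℕ r) _ refl) (<⇒<ᵇ c<c′))
    ; colsIncr   = λ {r} {r′} {c} r<r′ → <ᵇ⇒< _ _ (implicationᵇ⁻
        (allᵇ⁻ (allᵇ⁻ colsOK (∈-cells r c)) (∈-cells r′ c)) (≡⇒≡ᵇ (toℕ c) _ refl) (<⇒<ᵇ r<r′))
    }
    where
    selected : Y ∈ allVecs (allVecs (range 1 N) n) m × T (isBijective Y ∧ isIncreasing Y)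
    selected = ∈-filterᵇ⁻ {p = λ Y → isBijective Y ∧ isIncreasing Y} Y∈
    Y∈fillings : Y ∈ allVecs (allVecs (range 1 N) n) m
    Y∈fillings = proj₁ selected
    bijective : T (isBijective Y)
    bijective = proj₁ (to (T-∧ {isBijective Y}) (proj₂ selected))
    rowsOK : T (everyPair (rowTest Y))
    rowsOK = proj₁ (to (increasing⇔ Y) (proj₂ (to (T-∧ {isBijective Y}) (proj₂ selected))))
    colsOK : T (everyPair (colTest Y))
    colsOK = proj₂ (to (increasing⇔ Y) (proj₂ (to (T-∧ {isBijective Y}) (proj₂ selected))))

  IsSYT⇒syt : ∀ {Y} → IsSYT Y → Y ∈ syt n m
  IsSYT⇒syt {Y} isSYT = ∈-filterᵇ⁺
    (∈-allVecs⁺ _ Y (λ r → ∈-allVecs⁺ _ (lookup Y r) (λ c →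
      let (1≤e , e≤N) = inRange r c in ∈-range⁺ 1≤e (s≤s e≤N))))
    (from (T-∧ {isBijective Y}) (bijective , from (increasing⇔ Y) (rowsOK , colsOK)))
    where
    open IsSYT isSYT
    bijective : T (isBijective Y)
    bijective = allᵇ⁺ (range 1 N) (λ v∈ →
      let (1≤v , v<1+N) = ∈-range⁻ v∈ in ≡⇒≡ᵇ _ _ (occursOnce 1≤v (≤-pred v<1+N)))
    rowsOK : T (everyPair (rowTest Y))
    rowsOK = allᵇ⁺ (cells n m) λ { {r , c} _ → allᵇ⁺ (cells n m) λ { {r′ , c′} _ →
      implicationᵇ⁺ λ r≡r′ c<c′ → <⇒<ᵇ (subst (λ r″ → entry Y r c < entry Y r″ c′)
        (Finₚ.toℕ-injective (≡ᵇ⇒≡ _ _ r≡r′)) (rowsIncr (<ᵇ⇒< _ _ c<c′))) } }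
    colsOK : T (everyPair (colTest Y))
    colsOK = allᵇ⁺ (cells n m) λ { {r , c} _ → allᵇ⁺ (cells n m) λ { {r′ , c′} _ →
      implicationᵇ⁺ λ c≡c′ r<r′ → <⇒<ᵇ (subst (λ c″ → entry Y r c < entry Y r′ c″)
        (Finₚ.toℕ-injective (≡ᵇ⇒≡ _ _ c≡c′)) (colsIncr (<ᵇ⇒< _ _ r<r′))) } }

  record IsLatticeWord (w : List ℕ) : Set where
    field
      length≡ : length w ≡ N
      letters : ∀ {x} → x ∈ w → 1 ≤ x × x ≤ m
      weight  : ∀ {s} → 1 ≤ s → s ≤ m → occ s w ≡ n
      lattice : ∀ {p i} → p ≤ N → 1 ≤ i → suc i ≤ m → occ (suc i) (take p w) ≤ occ i (take p w)

  latticeWords⇒IsLatticeWord : ∀ {w} → w ∈ latticeWords n m → IsLatticeWord w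
  latticeWords⇒IsLatticeWord {w} w∈ = record
    { length≡ = proj₁ shape
    ; letters = λ x∈ → map₂ ≤-pred (∈-range⁻ (proj₂ shape x∈))
    ; weight  = λ 1≤s s≤m → ≡ᵇ⇒≡ _ _ (allᵇ⁻ {xs = range 1 m} weighted (∈-range⁺ 1≤s (s≤s s≤m)))
    ; lattice = prefixCondition
    }
    where
    selected : w ∈ allLists (range 1 m) N × T (hasWeight n m w ∧ isLatticeCond n m w)
    selected = ∈-filterᵇ⁻ {p = λ w → hasWeight n m w ∧ isLatticeCond n m w} w∈
    shape : length w ≡ N × (∀ {x} → x ∈ w → x ∈ range 1 m)
    shape = ∈-allLists⁻ (range 1 m) N (proj₁ selected)
    weighted : T (hasWeight n m w)
    weighted = proj₁ (to (T-∧ {hasWeight n m w}) (proj₂ selected))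
    lattice : T (isLatticeCond n m w)
    lattice = proj₂ (to (T-∧ {hasWeight n m w}) (proj₂ selected))
    prefixCondition : ∀ {p i} → p ≤ N → 1 ≤ i → suc i ≤ m → occ (suc i) (take p w) ≤ occ i (take p w)
    prefixCondition {zero}  _   _   _    = z≤n
    prefixCondition {suc p} p≤N 1≤i i<m = ≤ᵇ⇒≤ _ _
      (allᵇ⁻ (allᵇ⁻ {xs = range 1 N} lattice (∈-range⁺ (s≤s z≤n) (s≤s p≤N))) (∈-range⁺ 1≤i (<⇒<1+pred i<m)))

  IsLatticeWord⇒latticeWords : ∀ {w} → IsLatticeWord w → w ∈ latticeWords n m
  IsLatticeWord⇒latticeWords {w} lw = ∈-filterᵇ⁺
    (subst (λ k → w ∈ allLists (range 1 m) k) length≡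
      (∈-allLists⁺ (range 1 m) w (λ x∈ → let (1≤x , x≤m) = letters x∈ in ∈-range⁺ 1≤x (s≤s x≤m))))
    (from (T-∧ {hasWeight n m w}) (weighted , latticeOK))
    where
    open IsLatticeWord lw
    weighted : T (hasWeight n m w)
    weighted = allᵇ⁺ (range 1 m) (λ s∈ →
      let (1≤s , s<1+m) = ∈-range⁻ s∈ in ≡⇒≡ᵇ _ _ (weight 1≤s (≤-pred s<1+m)))
    latticeOK : T (isLatticeCond n m w)
    latticeOK = allᵇ⁺ (range 1 N) λ p∈ → allᵇ⁺ (range 1 (m ∸ 1)) λ i∈ →
      let (1≤i , i<) = ∈-range⁻ i∈ in
      ≤⇒≤ᵇ (lattice (≤-pred (proj₂ (∈-range⁻ p∈))) 1≤i (<1+pred⇒< 1≤i i<))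

  rowOfLetter : ∀ {s} → 1 ≤ s → s ≤ m → ∃[ r ] (suc (toℕ {m} r) ≡ s)
  rowOfLetter {suc ρ} _ ρ<m = fromℕ< ρ<m , cong suc (Finₚ.toℕ-fromℕ< ρ<m)

  -- The row index of the cell holding the value k (0 if there is none).
  rowOf : Filling n m → ℕ → ℕ
  rowOf Y k = maybe′ (toℕ ∘ proj₁) 0 (findᵇ (λ x → valueAt Y x ≡ᵇ k) (cells n m))

  readingWord : Filling n m → List ℕ
  readingWord Y = applyUpTo (λ j → suc (rowOf Y (suc j))) N

  descentTest : Filling n m → ℕ → Cell → Cell → Bool
  descentTest Y i (r , c) (r′ , c′) = (entry Y r c ≡ᵇ i) ∧ (entry Y r′ c′ ≡ᵇ suc i) ∧ (toℕ r <ᵇ toℕ r′)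

  isDescent≡ : ∀ Y i → isDescent Y i ≡ anyᵇ (λ x → anyᵇ (descentTest Y i x) (cells n m)) (cells n m)
  isDescent≡ Y i = refl

  tableauOf : List ℕ → Filling n m
  tableauOf w = tabulate (λ r → tabulate (λ c → suc (pos (suc (toℕ r)) (toℕ c) w)))

  entry-tableauOf : ∀ w r c → entry (tableauOf w) r c ≡ suc (pos (suc (toℕ r)) (toℕ c) w)
  entry-tableauOf w r c =
    trans (cong (λ row → lookup row c) (Vecₚ.lookup∘tabulate _ r)) (Vecₚ.lookup∘tabulate _ c)

  module StandardTableau {Y : Filling n m} (isSYT : IsSYT Y) where
    open IsSYT isSYT

    cell-unique : ∀ {r c r′ c′} → entry Y r c ≡ entry Y r′ c′ → (r , c) ≡ (r′ , c′)
    cell-unique {r} {c} {r′} {c′} e≡e′ =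
      countᵇ≡1⇒unique (cells n m) (occursOnce (proj₁ (inRange r c)) (proj₂ (inRange r c)))
        (∈-cells r c) (∈-cells r′ c′) (≡⇒≡ᵇ (entry Y r c) _ refl) (≡⇒≡ᵇ _ _ (sym e≡e′))

    cell-exists : ∀ {k} → 1 ≤ k → k ≤ N → ∃[ r ] ∃[ c ] (entry Y r c ≡ k)
    cell-exists 1≤k k≤N with countᵇ≡1⇒∃ (cells n m) (occursOnce 1≤k k≤N)
    ... | (r , c) , _ , e≡k = r , c , ≡ᵇ⇒≡ _ _ e≡k

    rowOf-entry : ∀ r c → rowOf Y (entry Y r c) ≡ toℕ r
    rowOf-entry r c = cong (maybe′ (toℕ ∘ proj₁) 0)
      (findᵇ-only (cells n m) (∈-cells r c) (≡⇒≡ᵇ (entry Y r c) _ refl)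
        (λ {(r′ , c′)} _ e′≡e → cell-unique (≡ᵇ⇒≡ _ _ e′≡e)))

    rowOf-< : ∀ {k} → 1 ≤ k → k ≤ N → rowOf Y k < m
    rowOf-< 1≤k k≤N with cell-exists 1≤k k≤N
    ... | r , c , refl = subst (_< m) (sym (rowOf-entry r c)) (Finₚ.toℕ<n r)

    row-count-value : ∀ r {v} → 1 ≤ v → v ≤ N →
                      countᵇ (λ c → entry Y r c ≡ᵇ v) (allFin n) ≡ ι (rowOf Y v ≡ᵇ toℕ r)
    row-count-value r 1≤v v≤N with cell-exists 1≤v v≤N
    ... | r₀ , c₀ , refl with r₀ Finₚ.≟ r
    ...   | yes refl = begin
      countᵇ (λ c → entry Y r c ≡ᵇ entry Y r c₀) (allFin n)
        ≡⟨ countᵇ≡1⁺ (allFin n) (Uniqueₚ.allFin⁺ n) (∈-allFin c₀) (≡⇒≡ᵇ (entry Y r c₀) _ refl)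
             (λ _ e≡e₀ → cong proj₂ (cell-unique (≡ᵇ⇒≡ _ _ e≡e₀))) ⟩
      1 ≡⟨ cong ι (sym (≡ᵇ-refl (toℕ r))) ⟩
      ι (toℕ r ≡ᵇ toℕ r) ≡⟨ cong (λ k → ι (k ≡ᵇ toℕ r)) (sym (rowOf-entry r c₀)) ⟩
      ι (rowOf Y (entry Y r c₀) ≡ᵇ toℕ r) ∎
      where open ≡-Reasoning
    ...   | no r₀≢r = begin
      countᵇ (λ c → entry Y r c ≡ᵇ entry Y r₀ c₀) (allFin n)
        ≡⟨ countᵇ-none (allFin n) (λ _ e≡e₀ → r₀≢r (sym (cong proj₁ (cell-unique (≡ᵇ⇒≡ _ _ e≡e₀))))) ⟩
      0 ≡⟨ cong ι (sym (≢⇒≡ᵇ-false (r₀≢r ∘ Finₚ.toℕ-injective))) ⟩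
      ι (toℕ r₀ ≡ᵇ toℕ r) ≡⟨ cong (λ k → ι (k ≡ᵇ toℕ r)) (sym (rowOf-entry r₀ c₀)) ⟩
      ι (rowOf Y (entry Y r₀ c₀) ≡ᵇ toℕ r) ∎
      where open ≡-Reasoning

    length-readingWord : length (readingWord Y) ≡ N
    length-readingWord = Listₚ.length-applyUpTo _ N

    occ-readingWord : ∀ r {p} → p ≤ N →
                      occ (suc (toℕ r)) (take p (readingWord Y)) ≡ countᵇ (λ c → entry Y r c ≤ᵇ p) (allFin n)
    occ-readingWord r {zero}  _     = sym (countᵇ-none (allFin n) (λ {c} _ e≤0 →
      <⇒≱ (proj₁ (inRange r c)) (≤ᵇ⇒≤ (entry Y r c) 0 e≤0)))
    occ-readingWord r {suc p} p<N = begin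
      occ s (take (suc p) w)
        ≡⟨ occ-take-suc s p w (subst (p <_) (sym length-readingWord) p<N) ⟩
      occ s (take p w) + ι (letterAt w p ≡ᵇ s)
        ≡⟨ cong₂ (λ o l → o + ι (l ≡ᵇ s)) (occ-readingWord r (<⇒≤ p<N)) (letterAt-applyUpTo _ p<N) ⟩
      countᵇ (λ c → entry Y r c ≤ᵇ p) (allFin n) + ι (rowOf Y (suc p) ≡ᵇ toℕ r)
        ≡⟨ cong (countᵇ (λ c → entry Y r c ≤ᵇ p) (allFin n) +_) (sym (row-count-value r (s≤s z≤n) p<N)) ⟩
      countᵇ (λ c → entry Y r c ≤ᵇ p) (allFin n) + countᵇ (λ c → entry Y r c ≡ᵇ suc p) (allFin n)
        ≡⟨ sym (countᵇ-split (allFin n) (λ {c} _ → ι-≤ᵇ-suc (entry Y r c) p)) ⟩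
      countᵇ (λ c → entry Y r c ≤ᵇ suc p) (allFin n) ∎
      where
      open ≡-Reasoning
      s : ℕ
      s = suc (toℕ r)
      w : List ℕ
      w = readingWord Y

    -- The reading word is a lattice word: column strictness gives the lattice condition.
    readingWord-isLatticeWord : IsLatticeWord (readingWord Y)
    readingWord-isLatticeWord = record
      { length≡ = length-readingWord
      ; letters = letters
      ; weight  = weight
      ; lattice = lattice
      }
      where
      w : List ℕ
      w = readingWord Y
      letters : ∀ {x} → x ∈ w → 1 ≤ x × x ≤ m
      letters x∈ with ∈-applyUpTo⁻ _ x∈
      ... | j , j<N , refl = s≤s z≤n , rowOf-< (s≤s z≤n) j<N
      weight : ∀ {s} → 1 ≤ s → s ≤ m → occ s w ≡ n
      weight 1≤s s≤m with rowOfLetter 1≤s s≤m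
      ... | r , refl = begin
        occ (suc (toℕ r)) w                          ≡⟨ sym (occ-take-length _ w) ⟩
        occ (suc (toℕ r)) (take (length w) w)         ≡⟨ cong (λ k → occ (suc (toℕ r)) (take k w)) length-readingWord ⟩
        occ (suc (toℕ r)) (take N w)                  ≡⟨ occ-readingWord r ≤-refl ⟩
        countᵇ (λ c → entry Y r c ≤ᵇ N) (allFin n)    ≡⟨ countᵇ-every (allFin n) (λ {c} _ → ≤⇒≤ᵇ (proj₂ (inRange r c))) ⟩
        length (allFin n)                             ≡⟨ Listₚ.length-tabulate (λ c → c) ⟩
        n                                             ∎
        where open ≡-Reasoning
      -- an entry ≤ p in row r+1 sits below an even smaller entry of row r
      lattice : ∀ {p i} → p ≤ N → 1 ≤ i → suc i ≤ m → occ (suc i) (take p w) ≤ occ i (take p w)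
      lattice {p} p≤N 1≤i i<m with rowOfLetter 1≤i (<⇒≤ i<m) | rowOfLetter (s≤s z≤n) i<m
      ... | r , refl | r′ , r′≡ = subst (λ s → occ s (take p w) ≤ occ (suc (toℕ r)) (take p w)) r′≡
        (subst₂ _≤_ (sym (occ-readingWord r′ p≤N)) (sym (occ-readingWord r p≤N))
          (countᵇ-mono (allFin n) (λ {c} _ e′≤p → ≤⇒≤ᵇ (<⇒≤ (<-≤-trans
            (colsIncr (≤-reflexive (sym (suc-injective r′≡))))
            (≤ᵇ⇒≤ (entry Y r′ c) p e′≤p))))))

    isDescent-rowOf : ∀ {i} → 1 ≤ i → suc i ≤ N → isDescent Y i ≡ (rowOf Y i <ᵇ rowOf Y (suc i))
    isDescent-rowOf {i} 1≤i i<N = T-ext descent⇒lower lower⇒descent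
      where
      rowOf-value : ∀ {r c k} → entry Y r c ≡ k → rowOf Y k ≡ toℕ r
      rowOf-value {r} {c} refl = rowOf-entry r c

      descent⇒lower : T (isDescent Y i) → T (rowOf Y i <ᵇ rowOf Y (suc i))
      descent⇒lower d with anyᵇ⁻ (cells n m) (subst T (isDescent≡ Y i) d)
      ... | (r , c) , _ , d′ with anyᵇ⁻ (cells n m) d′
      ... | (r′ , c′) , _ , d″ with to (T-∧ {entry Y r c ≡ᵇ i}) d″
      ... | e≡i , d‴ with to (T-∧ {entry Y r′ c′ ≡ᵇ suc i}) d‴
      ... | e′≡i+1 , r<r′ = subst₂ (λ a b → T (a <ᵇ b))
            (sym (rowOf-value (≡ᵇ⇒≡ _ _ e≡i))) (sym (rowOf-value (≡ᵇ⇒≡ _ _ e′≡i+1))) r<r′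

      lower⇒descent : T (rowOf Y i <ᵇ rowOf Y (suc i)) → T (isDescent Y i)
      lower⇒descent lower with cell-exists 1≤i (<⇒≤ i<N) | cell-exists (s≤s z≤n) i<N
      ... | r , c , e≡i | r′ , c′ , e′≡i+1 = subst T (sym (isDescent≡ Y i))
        (anyᵇ⁺ (∈-cells r c) (anyᵇ⁺ (∈-cells r′ c′)
          (from T-∧ (≡⇒≡ᵇ _ _ e≡i , from T-∧ (≡⇒≡ᵇ _ _ e′≡i+1 ,
            subst₂ (λ a b → T (a <ᵇ b)) (rowOf-value e≡i) (rowOf-value e′≡i+1) lower)))))

    des≡asc : des Y ≡ asc (readingWord Y)
    des≡asc = begin
      des Y
        ≡⟨ cong (countᵇ (isDescent Y)) (sym (Listₚ.map-upTo suc (N ∸ 1))) ⟩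
      countᵇ (isDescent Y) (map suc (upTo (N ∸ 1)))
        ≡⟨ countᵇ-map (isDescent Y) suc (upTo (N ∸ 1)) ⟩
      countᵇ (isDescent Y ∘ suc) (upTo (N ∸ 1))
        ≡⟨ countᵇ-cong (upTo (N ∸ 1)) (λ j∈ → isDescent-rowOf (s≤s z≤n) (j+2≤N j∈)) ⟩
      countᵇ (λ j → rowOf Y (suc j) <ᵇ rowOf Y (suc (suc j))) (upTo (N ∸ 1))
        ≡⟨ sym (asc-applyUpTo (λ j → suc (rowOf Y (suc j))) N) ⟩
      asc (readingWord Y) ∎
      where
      open ≡-Reasoning
      j+2≤N : ∀ {j} → j ∈ upTo (N ∸ 1) → suc (suc j) ≤ N
      j+2≤N j∈ with ∈-applyUpTo⁻ (λ j → j) j∈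
      ... | j , j<N∸1 , refl = <1+pred⇒< (s≤s z≤n) (s≤s j<N∸1)

    rowsIncr-≤ : ∀ {r c c′} → toℕ c ≤ toℕ c′ → entry Y r c ≤ entry Y r c′
    rowsIncr-≤ c≤c′ with m≤n⇒m<n∨m≡n c≤c′
    ... | inj₁ c<c′ = <⇒≤ (rowsIncr c<c′)
    ... | inj₂ c≡c′ = ≤-reflexive (cong (entry Y _) (Finₚ.toℕ-injective c≡c′))

    pos-readingWord : ∀ r c → suc (pos (suc (toℕ r)) (toℕ c) (readingWord Y)) ≡ entry Y r c
    pos-readingWord r c with entry Y r c in e≡ | inRange r c
    ... | suc j | _ , j<N = cong suc (begin
      pos s (toℕ c) w                ≡⟨ cong (λ k → pos s k w) (sym occ≡c) ⟩
      pos s (occ s (take j w)) w     ≡⟨ pos-occ s j w (subst (j <_) (sym length-readingWord) j<N) letter≡s ⟩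
      j                              ∎)
      where
      open ≡-Reasoning
      s : ℕ
      s = suc (toℕ r)
      w : List ℕ
      w = readingWord Y
      letter≡s : letterAt w j ≡ s
      letter≡s = trans (letterAt-applyUpTo _ j<N) (cong suc (trans (cong (rowOf Y) (sym e≡)) (rowOf-entry r c)))
      below⇔left : ∀ c′ → (entry Y r c′ ≤ᵇ j) ≡ (toℕ c′ <ᵇ toℕ c)
      below⇔left c′ = T-ext below⇒left left⇒below
        where
        below⇒left : T (entry Y r c′ ≤ᵇ j) → T (toℕ c′ <ᵇ toℕ c)
        below⇒left e′≤j with toℕ c′ <? toℕ c
        ... | yes c′<c = <⇒<ᵇ c′<c
        ... | no  c′≮c = ⊥-elim (<⇒≱ (s≤s (≤ᵇ⇒≤ _ j e′≤j)) (subst (_≤ entry Y r c′) e≡ (rowsIncr-≤ (≮⇒≥ c′≮c))))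
        left⇒below : T (toℕ c′ <ᵇ toℕ c) → T (entry Y r c′ ≤ᵇ j)
        left⇒below c′<c = ≤⇒≤ᵇ (≤-pred (subst (entry Y r c′ <_) e≡ (rowsIncr (<ᵇ⇒< _ _ c′<c))))
      occ≡c : occ s (take j w) ≡ toℕ c
      occ≡c = begin
        occ s (take j w)                                   ≡⟨ occ-readingWord r (<⇒≤ j<N) ⟩
        countᵇ (λ c′ → entry Y r c′ ≤ᵇ j) (allFin n)       ≡⟨ countᵇ-cong (allFin n) (λ {c′} _ → below⇔left c′) ⟩
        countᵇ (λ c′ → toℕ c′ <ᵇ toℕ c) (allFin n)         ≡⟨ countᵇ-below n (toℕ c) (<⇒≤ (Finₚ.toℕ<n c)) ⟩
        toℕ c                                              ∎

    tableauOf-readingWord : tableauOf (readingWord Y) ≡ Y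
    tableauOf-readingWord = begin
      tableauOf (readingWord Y)                   ≡⟨ Vecₚ.tabulate-cong (λ r → Vecₚ.tabulate-cong (pos-readingWord r)) ⟩
      tabulate (λ r → tabulate (entry Y r))       ≡⟨ Vecₚ.tabulate-cong (λ r → Vecₚ.tabulate∘lookup (lookup Y r)) ⟩
      tabulate (lookup Y)                         ≡⟨ Vecₚ.tabulate∘lookup Y ⟩
      Y                                           ∎
      where open ≡-Reasoning

  module LatticeWord {w : List ℕ} (lw : IsLatticeWord w) where
    open IsLatticeWord lw

    -- Each letter 1 ≤ s ≤ m occurs n times, so its occurrences 0 … n-1 are all found.
    pos-valid : ∀ {s c} → 1 ≤ s → s ≤ m → c < n →
                pos s c w < N × letterAt w (pos s c w) ≡ s × occ s (take (pos s c w) w) ≡ c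
    pos-valid {s} {c} 1≤s s≤m c<n with pos-spec s c w (subst (c <_) (sym (weight 1≤s s≤m)) c<n)
    ... | p<∣w∣ , letter≡s , occ≡c = subst (pos s c w <_) length≡ p<∣w∣ , letter≡s , occ≡c

    -- The lattice condition: occurrence number c of s precedes occurrence number c of s+1.
    pos-next-letter : ∀ {s c} → 1 ≤ s → suc s ≤ m → c < n → pos s c w < pos (suc s) c w
    pos-next-letter {s} {c} 1≤s s<m c<n = ≤∧≢⇒< (≤-pred (pos-<-prefix s c (suc p′) w c<occ)) p≢p′
      where
      p′ : ℕ
      p′ = pos (suc s) c w
      valid : pos s c w < N × letterAt w (pos s c w) ≡ s × occ s (take (pos s c w) w) ≡ c
      valid = pos-valid 1≤s (<⇒≤ s<m) c<n
      valid′ : p′ < N × letterAt w p′ ≡ suc s × occ (suc s) (take p′ w) ≡ c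
      valid′ = pos-valid (s≤s z≤n) s<m c<n
      c<occ : c < occ s (take (suc p′) w)
      c<occ = begin-strict
        c                             <⟨ n<1+n c ⟩
        suc c                         ≡⟨ +-comm 1 c ⟩
        c + 1                         ≡⟨ cong₂ (λ o l → o + ι l) (sym (proj₂ (proj₂ valid′)))
                                               (sym (trans (cong (_≡ᵇ suc s) (proj₁ (proj₂ valid′))) (≡ᵇ-refl (suc s)))) ⟩
        occ (suc s) (take p′ w) + ι (letterAt w p′ ≡ᵇ suc s)
                                      ≡⟨ sym (occ-take-suc (suc s) p′ w (subst (p′ <_) (sym length≡) (proj₁ valid′))) ⟩
        occ (suc s) (take (suc p′) w) ≤⟨ lattice (proj₁ valid′) 1≤s s<m ⟩
        occ s (take (suc p′) w)       ∎
        where open ≤-Reasoning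
      p≢p′ : pos s c w ≢ p′
      p≢p′ p≡p′ = 1+n≢n (trans (sym (proj₁ (proj₂ valid′))) (trans (cong (letterAt w) (sym p≡p′)) (proj₁ (proj₂ valid))))

    -- Hence columns of the tableau of w increase downwards.
    pos-later-letter : ∀ {s s′ c} → 1 ≤ s → s < s′ → s′ ≤ m → c < n → pos s c w < pos s′ c w
    pos-later-letter {s} {suc s′} 1≤s s<s′ s′≤m c<n with m≤n⇒m<n∨m≡n (≤-pred s<s′)
    ... | inj₂ refl  = pos-next-letter 1≤s s′≤m c<n
    ... | inj₁ s<s′′ = <-trans (pos-later-letter 1≤s s<s′′ (<⇒≤ s′≤m) c<n)
                               (pos-next-letter (≤-trans 1≤s (<⇒≤ s<s′′)) s′≤m c<n)

    pos-cell : ∀ (r : Fin m) (c : Fin n) → let p = pos (suc (toℕ r)) (toℕ c) w in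
               p < N × letterAt w p ≡ suc (toℕ r) × occ (suc (toℕ r)) (take p w) ≡ toℕ c
    pos-cell r c = pos-valid (s≤s z≤n) (Finₚ.toℕ<n r) (Finₚ.toℕ<n c)

    tableauOf-cell-unique : ∀ {r c r′ c′} → entry (tableauOf w) r c ≡ entry (tableauOf w) r′ c′ →
                            (r , c) ≡ (r′ , c′)
    tableauOf-cell-unique {r} {c} {r′} {c′} e≡e′ = cong₂ _,_ (Finₚ.toℕ-injective (suc-injective s≡s′))
      (Finₚ.toℕ-injective (trans (sym occ≡c) (trans (cong₂ (λ s p → occ s (take p w)) s≡s′ p≡p′) occ≡c′)))
      where
      p≡p′ : pos (suc (toℕ r)) (toℕ c) w ≡ pos (suc (toℕ r′)) (toℕ c′) w
      p≡p′ = suc-injective (trans (sym (entry-tableauOf w r c)) (trans e≡e′ (entry-tableauOf w r′ c′)))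
      occ≡c : occ (suc (toℕ r)) (take (pos (suc (toℕ r)) (toℕ c) w) w) ≡ toℕ c
      occ≡c = proj₂ (proj₂ (pos-cell r c))
      occ≡c′ : occ (suc (toℕ r′)) (take (pos (suc (toℕ r′)) (toℕ c′) w) w) ≡ toℕ c′
      occ≡c′ = proj₂ (proj₂ (pos-cell r′ c′))
      s≡s′ : suc (toℕ r) ≡ suc (toℕ r′)
      s≡s′ = trans (sym (proj₁ (proj₂ (pos-cell r c))))
               (trans (cong (letterAt w) p≡p′) (proj₁ (proj₂ (pos-cell r′ c′))))

    cell-of-position : ∀ {j} → j < N →
                       ∃[ r ] ∃[ c ] (entry (tableauOf w) r c ≡ suc j × suc (toℕ r) ≡ letterAt w j)
    cell-of-position {j} j<N with letters (letterAt-∈ w j (subst (j <_) (sym length≡) j<N))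
    ... | 1≤s , s≤m with rowOfLetter 1≤s s≤m
    ... | r , r+1≡s = r , fromℕ< c<n , entry≡ , r+1≡s
      where
      j<∣w∣ : j < length w
      j<∣w∣ = subst (j <_) (sym length≡) j<N
      s : ℕ
      s = letterAt w j
      c<n : occ s (take j w) < n
      c<n = subst (occ s (take j w) <_) (weight 1≤s s≤m) (occ-take-< s j w j<∣w∣ refl)
      entry≡ : entry (tableauOf w) r (fromℕ< c<n) ≡ suc j
      entry≡ = trans (entry-tableauOf w r (fromℕ< c<n)) (cong suc (begin
        pos (suc (toℕ r)) (toℕ (fromℕ< c<n)) w ≡⟨ cong₂ (λ a b → pos a b w) r+1≡s (Finₚ.toℕ-fromℕ< c<n) ⟩
        pos s (occ s (take j w)) w              ≡⟨ pos-occ s j w j<∣w∣ refl ⟩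
        j                                       ∎))
        where open ≡-Reasoning

    tableauOf-isSYT : IsSYT (tableauOf w)
    tableauOf-isSYT = record
      { inRange    = λ r c → subst (λ e → 1 ≤ e × e ≤ N) (sym (entry-tableauOf w r c))
                               (s≤s z≤n , proj₁ (pos-cell r c))
      ; occursOnce = occursOnce
      ; rowsIncr   = λ {r} {c} {c′} c<c′ → subst₂ _<_ (sym (entry-tableauOf w r c)) (sym (entry-tableauOf w r c′))
                       (s≤s (pos-mono _ _ _ w c<c′
                         (subst (toℕ c′ <_) (sym (weight (s≤s z≤n) (Finₚ.toℕ<n r))) (Finₚ.toℕ<n c′))))
      ; colsIncr   = λ {r} {r′} {c} r<r′ → subst₂ _<_ (sym (entry-tableauOf w r c)) (sym (entry-tableauOf w r′ c))
                       (s≤s (pos-later-letter (s≤s z≤n) (s≤s r<r′) (Finₚ.toℕ<n r′) (Finₚ.toℕ<n c)))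
      }
      where
      occursOnce : ∀ {v} → 1 ≤ v → v ≤ N → countᵇ (λ x → valueAt (tableauOf w) x ≡ᵇ v) (cells n m) ≡ 1
      occursOnce {suc j} _ j<N with cell-of-position j<N
      ... | r , c , e≡v , _ = countᵇ≡1⁺ (cells n m) (cells-unique n m) (∈-cells r c) (≡⇒≡ᵇ _ _ e≡v)
              (λ {(r′ , c′)} _ e′≡v → tableauOf-cell-unique (trans (≡ᵇ⇒≡ _ _ e′≡v) (sym e≡v)))

    readingWord-tableauOf : readingWord (tableauOf w) ≡ w
    readingWord-tableauOf = begin
      applyUpTo (λ j → suc (rowOf (tableauOf w) (suc j))) N ≡⟨ applyUpTo-cong-< N letter≡ ⟩
      applyUpTo (letterAt w) N                              ≡⟨ cong (applyUpTo (letterAt w)) (sym length≡) ⟩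
      applyUpTo (letterAt w) (length w)                     ≡⟨ applyUpTo-letterAt w ⟩
      w                                                     ∎
      where
      open ≡-Reasoning
      open StandardTableau tableauOf-isSYT using (rowOf-entry)
      letter≡ : ∀ {j} → j < N → suc (rowOf (tableauOf w) (suc j)) ≡ letterAt w j
      letter≡ j<N with cell-of-position j<N
      ... | r , c , e≡ , r+1≡ = trans (cong (suc ∘ rowOf (tableauOf w)) (sym e≡)) (trans (cong suc (rowOf-entry r c)) r+1≡)

-- The theorem: readingWord is a bijection 𝒯_(n^m) → 𝒩(n,m), with inverse tableauOf, that
-- carries des to asc; both enumerations are duplicate-free, so the sums agree.
lemma2p2 : (m n : ℕ) → 1 Data.Nat.≤ m → 1 Data.Nat.≤ n → (t : ℕ) →
    sum (map (λ T → t ^ des T) (syt n m)) ≡ sum (map (λ w → t ^ asc w) (latticeWords n m))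
lemma2p2 m n _ _ t =
  sum-bijection readingWord tableauOf (λ Y → t ^ des Y) (λ w → t ^ asc w)
    (Uniqueₚ.filter⁺ (λ Y → T? (isBijective Y ∧ isIncreasing Y))
      (allVecs-unique _ (allVecs-unique _ (range-unique 1 N) n) m))
    (Uniqueₚ.filter⁺ (λ w → T? (hasWeight n m w ∧ isLatticeCond n m w))
      (allLists-unique _ (range-unique 1 m) N))
    (λ Y∈ → IsLatticeWord⇒latticeWords (StandardTableau.readingWord-isLatticeWord (syt⇒IsSYT Y∈)))
    (λ w∈ → IsSYT⇒syt (LatticeWord.tableauOf-isSYT (latticeWords⇒IsLatticeWord w∈)))
    (λ Y∈ → StandardTableau.tableauOf-readingWord (syt⇒IsSYT Y∈))
    (λ w∈ → LatticeWord.readingWord-tableauOf (latticeWords⇒IsLatticeWord w∈))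
    (λ Y∈ → cong (t ^_) (StandardTableau.des≡asc (syt⇒IsSYT Y∈)))
  where open RectangularShape n m
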